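{- Let $r\ge 2$, let $\mathcal{H}$ be an $r$-uniform hypergraph on $[n]$, let $i\in[n]$ and $k\geq 1$. (i) If $k=1$, then $N(S_{r-1,1}^r,\mathcal{H})=N(S_{r-1,1}^r,\mathcal{H}-\{i\})+N(S_{r-2,1}^{r-1},\mathcal{L}_i(\mathcal{H}))$. (ii) If $k\geq 2$, then $$N(S_{r-1,k}^r,\mathcal{H})\leq N(S_{r-1,k}^r,\mathcal{H}-\{i\})+N(S_{r-2,k}^{r-1},\mathcal{L}_i(\mathcal{H}))+e(\mathcal{H}-\{i\})\cdot\frac{r}{k-1}\binom{n-r-1}{k-2}.$$
   Context: An $r$-uniform hypergraph is identified with its set of hyperedges; $e(\mathcal{H})$ is the number of hyperedges. For a vertex set $U$, $\mathcal{H}-U$ is obtained by deleting the vertices of $U$ and all hyperedges meeting $U$. The link of a vertex $v$ is the $(r-1)$-uniform hypergraph $\mathcal{L}_v(\mathcal{H})=\{e\setminus\{v\}: e\in\mathcal{H}, v\in e\}$. For integers $r>t\ge0$, $k\ge1$, $S_{t,k}^r$ is the $r$-uniform hypergraph with hyperedges $e_1,\dots,e_k$ such that there is a $t$-set $T$ with $e_a\cap e_b=T$ for all $1\le a<b\le k$ (a single hyperedge when $k=1$). $N(\mathcal{F},\mathcal{G})$ is the number of subhypergraphs of $\mathcal{G}$ isomorphic to $\mathcal{F}$. Binomial coefficients $\binom{a}{b}$ are $0$ when $a<b$, and $\binom{0}{0}=1$. -}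

module Defs where

open import Data.Bool using (Bool; true; false; _∧_; not)
open import Data.Nat using (ℕ; zero; suc; _≟_)
open import Data.Fin using (Fin)
open import Data.Fin.Subset using (Subset; _∩_; _∪_; _⊆_; ∣_∣; ⁅_⁆; inside; outside)
open import Data.Fin.Subset.Properties using (anySubset?; _⊆?_; _∈?_)
open import Data.List using (List; []; _∷_; _++_; map; length; filter)
open import Data.List.Relation.Unary.All using (All)
open import Data.List.Relation.Unary.All.Properties using ()
import Data.List.Relation.Unary.All as All
open import Data.List.Relation.Unary.AllPairs using (AllPairs; allPairs?)
open import Data.Vec using ([]; _∷_)
open import Data.Product using (Σ; _×_; _,_)
open import Relation.Binary.PropositionalEquality using (_≡_)
open import Relation.Nullary using (Dec; does)
open import Relation.Nullary.Decidable using (_×-dec_)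
import Data.Vec.Properties as VP
import Data.Bool.Properties as BP

-- An (r-uniform) hypergraph on the vertex set [n] = Fin n, identified with
-- its set of hyperedges, given by its (decidable) characteristic function on
-- the subsets of [n].
Hypergraph : ℕ → Set
Hypergraph n = Subset n → Bool

Uniform : ∀ {n} → ℕ → Hypergraph n → Set
Uniform {n} r H = (e : Subset n) → H e ≡ true → ∣ e ∣ ≡ r

allSubsets : (n : ℕ) → List (Subset n)
allSubsets zero    = [] ∷ []
allSubsets (suc n) = map (inside ∷_) (allSubsets n) ++ map (outside ∷_) (allSubsets n)

-- The hyperedges of H, each listed exactly once.
edges : ∀ {n} → Hypergraph n → List (Subset n)
edges {n} H = filter (λ e → H e BP.≟ true) (allSubsets n)

eH : ∀ {n} → Hypergraph n → ℕ
eH H = length (edges H)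

-- H - {i}: delete vertex i and all hyperedges meeting it.
-- (The vertex i is kept in the ambient type Fin n but no hyperedge contains it;
-- this does not affect hyperedge counts.)
delV : ∀ {n} → Hypergraph n → Fin n → Hypergraph n
delV H i e = H e ∧ not (does (i ∈? e))

-- Link of i: e is in L_i(H) iff e = f \ {i} for some f ∈ H with i ∈ f,
-- i.e. iff i ∉ e and e ∪ {i} ∈ H.
link : ∀ {n} → Hypergraph n → Fin n → Hypergraph n
link H i e = not (does (i ∈? e)) ∧ H (e ∪ ⁅ i ⁆)

choose : ∀ {a} {A : Set a} → ℕ → List A → List (List A)
choose zero    xs       = [] ∷ []
choose (suc k) []       = []
choose (suc k) (x ∷ xs) = map (x ∷_) (choose k xs) ++ choose (suc k) xs

-- A list of hyperedges forms a copy of S^r_{t,k} (k = its length, the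
-- hyperedges being distinct): each hyperedge has size r, and there is a
-- t-set T contained in every hyperedge such that all pairwise
-- intersections equal T.
IsSunflower : ∀ {n} → ℕ → ℕ → List (Subset n) → Set
IsSunflower {n} r t es =
  All (λ e → ∣ e ∣ ≡ r) es ×
  Σ (Subset n) (λ T → (∣ T ∣ ≡ t) × All (λ e → T ⊆ e) es × AllPairs (λ a b → a ∩ b ≡ T) es)

isSunflower? : ∀ {n} (r t : ℕ) (es : List (Subset n)) → Dec (IsSunflower r t es)
isSunflower? r t es =
  All.all? (λ e → ∣ e ∣ ≟ r) es ×-dec
  anySubset? (λ T → (∣ T ∣ ≟ t) ×-dec (All.all? (λ e → T ⊆? e) es ×-dec
                     allPairs? (λ a b → VP.≡-dec BP._≟_ (a ∩ b) T) es))

N : ∀ {n} → (r t k : ℕ) → Hypergraph n → ℕ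
N r t k G = length (filter (isSunflower? r t) (choose k (edges G)))

-- Split the edges of H into those through i and those avoiding i.  Let S be a
-- copy of S^r_{r-1,k} with k ≥ 2.  If two edges of S pass through i, then i lies
-- in the core, so all of them do, and deleting i gives a copy of S^{r-1}_{r-2,k}
-- in the link.  If none does, S lies in H - {i}.  Otherwise exactly one edge
-- a ∪ {i} passes through i; since |a| = r - 1 is the size of the core, every
-- other edge of S contains a.  So there are at most C(d, k-1) such S, where
-- d ≤ n - r is the number of edges of H - {i} containing a, and
-- (k-1) C(d, k-1) = d C(d-1, k-2) ≤ d C(n-r-1, k-2).  Summing d over all a counts
-- the pairs a ⊂ c with c an edge of H - {i}, and each c contains at most r
-- such a.  For k = 1 both sides of (i) just count edges.

module Submission where

open import Level using (Level; _⊔_) renaming (suc to lsuc)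
open import Function using (_∘_; flip; case_of_)
open import Data.Bool using (true; false; _∧_; not)
open import Data.Bool.Properties using (∨-identityʳ; ∧-zeroʳ; ∧-identityʳ)
import Data.Bool.Properties as Bool
open import Data.Fin using (Fin; zero; suc)
open import Data.Fin.Subset using (Subset; Side; inside; outside; _∈_; _∉_; _⊆_; _∩_; _∪_; ∣_∣; ⁅_⁆; ⊥)
open import Data.Fin.Subset.Properties
  using (_∈?_; _⊆?_; drop-∷-⊆; out⊆; in⊆in; ⊥⊆; ∣⊥∣≡0; ∣p∣≤n; p⊆q⇒∣p∣≤∣q∣; ∣p∩q∣≤∣p∣; ∩-comm; ∪-identityʳ; x∈p∩q⁺)
open import Data.Vec using ([]; _∷_; here; there; insertAt; removeAt)
open import Data.Vec.Properties using (removeAt-insertAt)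
open import Data.Product using (Σ; _×_; _,_)
open import Data.Nat using (ℕ; zero; suc; _+_; _*_; _∸_; _≤_; z≤n; s≤s; _≟_)
open import Data.Nat.Properties
open import Data.Nat.ListAction using (sum)
open import Data.Nat.Combinatorics using (_C_; nCk+nC[k+1]≡[n+1]C[k+1]; nC1≡n; nCk≡nC[n∸k])
open import Data.List using (List; []; _∷_; _++_; map; length; filter; [_])
open import Data.List.Properties
  using (length-++; length-map; map-++; map-∘; filter-all; filter-++; filter-none; filter-≐; length-filter)
open import Data.List.Relation.Unary.All as All using (All; []; _∷_)
import Data.List.Relation.Unary.All.Properties as All
open import Data.List.Relation.Binary.Permutation.Propositional
  using (_↭_; refl; prep; swap; trans; ↭-trans; ↭-reflexive; ↭-sym; ↭⇒↭ₛ; module PermutationReasoning)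
open import Data.List.Relation.Binary.Permutation.Propositional.Properties
  using (++-commutativeMonoid; filter-↭; ↭-length; All-resp-↭) renaming (++⁺ to ↭-++⁺; map⁺ to ↭-map⁺)
import Data.List.Relation.Binary.Permutation.Setoid.Properties as ↭ₛ-Properties
open import Data.List.Relation.Unary.AllPairs using ([]; _∷_)
import Data.List.Relation.Unary.AllPairs as AllPairs
import Data.List.Relation.Unary.AllPairs.Properties as AllPairs
open import Algebra.Bundles using (CommutativeMonoid)
open import Relation.Binary.Core using (REL)
open import Relation.Binary.Definitions using (_Respects_) renaming (Decidable to Decidable₂)
open import Relation.Binary.PropositionalEquality using (_≡_; refl; sym; cong; cong₂; subst; resp₂; setoid; module ≡-Reasoning)
  renaming (trans to ≡-trans)
open import Relation.Nullary using (¬_; yes; no; does; contradiction)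
open import Relation.Nullary.Decidable using (dec-true; dec-false; _×-dec_)
open import Relation.Unary using (Pred; Decidable; ∁; _≐_)
open import Defs using (choose; allSubsets; IsSunflower; isSunflower?; Hypergraph; Uniform; edges; eH; delV; link; N)
import Algebra.Properties.CommutativeSemigroup as CommSemigroupProperties
open import Data.Nat.Solver using (module +-*-Solver)
open +-*-Solver using (solve; _:+_; _:=_)

private
  module ℕ-CS = CommSemigroupProperties +-commutativeSemigroup

  variable
    a b p q : Level
    A : Set a
    B : Set b
    m n : ℕ

-- Counting sublists

count : {P : Pred A p} → Decidable P → List A → ℕ
count P? xs = length (filter P? xs)

module _ {P : Pred A p} (P? : Decidable P) where

  count-++ : ∀ xs ys → count P? (xs ++ ys) ≡ count P? xs + count P? ys
  count-++ xs ys = ≡-trans (cong length (filter-++ P? xs ys)) (length-++ (filter P? xs))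

  count-none : ∀ {xs} → All (∁ P) xs → count P? xs ≡ 0
  count-none ¬Ps = cong length (filter-none P? ¬Ps)

  count-all : ∀ {xs} → All P xs → count P? xs ≡ length xs
  count-all Ps = cong length (filter-all P? Ps)

module _ {P : Pred A p} {Q : Pred A q} (P? : Decidable P) (Q? : Decidable Q) where

  count-mono : ∀ {xs} → All (λ x → P x → Q x) xs → count P? xs ≤ count Q? xs
  count-mono {[]}     []         = z≤n
  count-mono {x ∷ xs} (P⇒Q ∷ hs) with P? x | Q? x
  ... | yes _  | yes _  = s≤s (count-mono hs)
  ... | yes px | no ¬qx = contradiction (P⇒Q px) ¬qx
  ... | no _   | yes _  = m≤n⇒m≤1+n (count-mono hs)
  ... | no _   | no _   = count-mono hs

  count-≐ : P ≐ Q → ∀ xs → count P? xs ≡ count Q? xs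
  count-≐ P≐Q xs = cong length (filter-≐ P? Q? P≐Q xs)

count-map : {P : Pred B p} (P? : Decidable P) (f : A → B) (xs : List A) →
            count P? (map f xs) ≡ count (P? ∘ f) xs
count-map P? f []       = refl
count-map P? f (x ∷ xs) with P? (f x)
... | yes _ = cong suc (count-map P? f xs)
... | no _  = count-map P? f xs

count-∷-excluded : {P : Pred (List A) p} {Q : Pred A q} (P? : Decidable P) → (∀ {es} → P es → All Q es) →
  ∀ {x} → ¬ Q x → ∀ yss → count (P? ∘ (x ∷_)) yss ≡ 0
count-∷-excluded P? P⇒Q ¬Qx yss = count-none (P? ∘ (_ ∷_)) (All.universal (λ _ → ¬Qx ∘ All.head ∘ P⇒Q) yss)

filter-map : {P : Pred B p} (P? : Decidable P) (f : A → B) (xs : List A) →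
             filter P? (map f xs) ≡ map f (filter (P? ∘ f) xs)
filter-map P? f []       = refl
filter-map P? f (x ∷ xs) with P? (f x)
... | yes _ = cong (f x ∷_) (filter-map P? f xs)
... | no _  = filter-map P? f xs

count-cong : {P : Pred A p} {Q : Pred A q} (P? : Decidable P) (Q? : Decidable Q) →
  (∀ x → does (P? x) ≡ does (Q? x)) → ∀ xs → count P? xs ≡ count Q? xs
count-cong P? Q? same []       = refl
count-cong P? Q? same (x ∷ xs) with P? x | Q? x | same x
... | yes _ | yes _ | _ = cong suc (count-cong P? Q? same xs)
... | no _  | no _  | _ = count-cong P? Q? same xs

count-filter-mono : {P : Pred A p} {Q : Pred A q} {R : Pred A b} (P? : Decidable P) (Q? : Decidable Q) (R? : Decidable R) →
  (∀ {x} → P x → Q x → R x) → ∀ xs → count Q? (filter P? xs) ≤ count R? xs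
count-filter-mono P? Q? R? h []       = z≤n
count-filter-mono P? Q? R? h (x ∷ xs) with P? x
... | no _ with R? x
...   | yes _ = m≤n⇒m≤1+n (count-filter-mono P? Q? R? h xs)
...   | no _  = count-filter-mono P? Q? R? h xs
count-filter-mono P? Q? R? h (x ∷ xs) | yes px with Q? x | R? x
...   | yes qx | yes _  = s≤s (count-filter-mono P? Q? R? h xs)
...   | yes qx | no ¬rx = contradiction (h px qx) ¬rx
...   | no _   | yes _  = m≤n⇒m≤1+n (count-filter-mono P? Q? R? h xs)
...   | no _   | no _   = count-filter-mono P? Q? R? h xs

module _ {P : Pred (List A) p} (P? : Decidable P) where

  count-choose-∷ : ∀ k x xs →
    count P? (choose (suc k) (x ∷ xs)) ≡ count (P? ∘ (x ∷_)) (choose k xs) + count P? (choose (suc k) xs)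
  count-choose-∷ k x xs = ≡-trans (count-++ P? (map (x ∷_) (choose k xs)) (choose (suc k) xs))
                                  (cong (_+ _) (count-map P? (x ∷_) (choose k xs)))

count-choose-map : {P : Pred (List B) p} (P? : Decidable P) (f : A → B) →
  ∀ k xs → count P? (choose k (map f xs)) ≡ count (P? ∘ map f) (choose k xs)
count-choose-map P? f zero    xs with P? []
... | yes _ = refl
... | no _  = refl
count-choose-map P? f (suc k) []       = refl
count-choose-map P? f (suc k) (x ∷ xs) = begin
  count P? (choose (suc k) (f x ∷ map f xs))
    ≡⟨ count-choose-∷ P? k (f x) (map f xs) ⟩
  count (P? ∘ (f x ∷_)) (choose k (map f xs)) + count P? (choose (suc k) (map f xs))
    ≡⟨ cong₂ _+_ (count-choose-map (P? ∘ (f x ∷_)) f k xs) (count-choose-map P? f (suc k) xs) ⟩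
  count (P? ∘ map f ∘ (x ∷_)) (choose k xs) + count (P? ∘ map f) (choose (suc k) xs)
    ≡⟨ count-choose-∷ (P? ∘ map f) k x xs ⟨
  count (P? ∘ map f) (choose (suc k) (x ∷ xs)) ∎
  where open ≡-Reasoning

choose-1 : (xs : List A) → choose 1 xs ≡ map [_] xs
choose-1 []       = refl
choose-1 (x ∷ xs) = cong ([ x ] ∷_) (choose-1 xs)

choose-length : ∀ k (xs : List A) → All (λ ys → length ys ≡ k) (choose k xs)
choose-length zero    xs       = refl ∷ []
choose-length (suc k) []       = []
choose-length (suc k) (x ∷ xs) =
  All.++⁺ (All.map⁺ (All.map (cong suc) (choose-length k xs))) (choose-length (suc k) xs)

-- Quantified over all permutation-invariant predicates so that the induction
-- on _↭_ can shift the predicate past a common head.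
SameChooseCounts : {A : Set a} → ∀ p → List A → List A → Set (a ⊔ lsuc p)
SameChooseCounts {A = A} p xs ys = ∀ {P : Pred (List A) p} (P? : Decidable P) → P Respects _↭_ →
  ∀ k → count P? (choose k xs) ≡ count P? (choose k ys)

module _ {p : Level} {A : Set a} where

  SameChooseCounts-∷ : ∀ x {xs ys : List A} → SameChooseCounts p xs ys → SameChooseCounts p (x ∷ xs) (x ∷ ys)
  SameChooseCounts-∷ x {xs} {ys} same P? resp zero    = refl
  SameChooseCounts-∷ x {xs} {ys} same P? resp (suc k) = begin
    count P? (choose (suc k) (x ∷ xs))
      ≡⟨ count-choose-∷ P? k x xs ⟩
    count (P? ∘ (x ∷_)) (choose k xs) + count P? (choose (suc k) xs)
      ≡⟨ cong₂ _+_ (same (P? ∘ (x ∷_)) (resp ∘ prep x) k) (same P? resp (suc k)) ⟩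
    count (P? ∘ (x ∷_)) (choose k ys) + count P? (choose (suc k) ys)
      ≡⟨ count-choose-∷ P? k x ys ⟨
    count P? (choose (suc k) (x ∷ ys)) ∎
    where open ≡-Reasoning

  SameChooseCounts-swap : ∀ x y (zs : List A) → SameChooseCounts p (x ∷ y ∷ zs) (y ∷ x ∷ zs)
  SameChooseCounts-swap x y zs P? resp zero = refl
  SameChooseCounts-swap x y zs P? resp (suc zero) = begin
    count P? (choose 1 (x ∷ y ∷ zs))          ≡⟨ count-choose-∷ P? 0 x (y ∷ zs) ⟩
    cx + count P? (choose 1 (y ∷ zs))         ≡⟨ cong (cx +_) (count-choose-∷ P? 0 y zs) ⟩
    cx + (cy + count P? (choose 1 zs))        ≡⟨ ℕ-CS.x∙yz≈y∙xz cx cy _ ⟩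
    cy + (cx + count P? (choose 1 zs))        ≡⟨ cong (cy +_) (count-choose-∷ P? 0 x zs) ⟨
    cy + count P? (choose 1 (x ∷ zs))         ≡⟨ count-choose-∷ P? 0 y (x ∷ zs) ⟨
    count P? (choose 1 (y ∷ x ∷ zs))          ∎
    where
      open ≡-Reasoning
      cx cy : ℕ
      cx = count (P? ∘ (x ∷_)) (choose 0 zs)
      cy = count (P? ∘ (y ∷_)) (choose 0 zs)
  SameChooseCounts-swap x y zs {P} P? resp (suc (suc k)) = begin
    count P? (choose (2 + k) (x ∷ y ∷ zs))
      ≡⟨ count-choose-∷ P? (suc k) x (y ∷ zs) ⟩
    count (P? ∘ (x ∷_)) (choose (suc k) (y ∷ zs)) + count P? (choose (2 + k) (y ∷ zs))
      ≡⟨ cong₂ _+_ (count-choose-∷ (P? ∘ (x ∷_)) k y zs) (count-choose-∷ P? (suc k) y zs) ⟩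
    (cxy + cx) + (cy + rest)
      ≡⟨ cong (λ c → (c + cx) + (cy + rest)) (count-≐ _ _ (swapped x y , swapped y x) (choose k zs)) ⟩
    (cyx + cx) + (cy + rest)
      ≡⟨ ℕ-CS.interchange cyx cx cy rest ⟩
    (cyx + cy) + (cx + rest)
      ≡⟨ cong₂ _+_ (count-choose-∷ (P? ∘ (y ∷_)) k x zs) (count-choose-∷ P? (suc k) x zs) ⟨
    count (P? ∘ (y ∷_)) (choose (suc k) (x ∷ zs)) + count P? (choose (2 + k) (x ∷ zs))
      ≡⟨ count-choose-∷ P? (suc k) y (x ∷ zs) ⟨
    count P? (choose (2 + k) (y ∷ x ∷ zs)) ∎
    where
      open ≡-Reasoning
      swapped : ∀ u v {es} → P (u ∷ v ∷ es) → P (v ∷ u ∷ es)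
      swapped u v = resp (swap u v refl)
      cxy cyx cx cy rest : ℕ
      cxy = count (P? ∘ (λ es → x ∷ y ∷ es)) (choose k zs)
      cyx = count (P? ∘ (λ es → y ∷ x ∷ es)) (choose k zs)
      cx  = count (P? ∘ (x ∷_)) (choose (suc k) zs)
      cy  = count (P? ∘ (y ∷_)) (choose (suc k) zs)
      rest = count P? (choose (2 + k) zs)

  ↭⇒SameChooseCounts : {xs ys : List A} → xs ↭ ys → SameChooseCounts p xs ys
  ↭⇒SameChooseCounts refl        P? resp k = refl
  ↭⇒SameChooseCounts (prep x ρ)  = SameChooseCounts-∷ x (↭⇒SameChooseCounts ρ)
  ↭⇒SameChooseCounts (swap x y ρ) P? resp k = ≡-trans (SameChooseCounts-swap x y _ P? resp k)
    (SameChooseCounts-∷ y (SameChooseCounts-∷ x (↭⇒SameChooseCounts ρ)) P? resp k)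
  ↭⇒SameChooseCounts (trans ρ σ) P? resp k =
    ≡-trans (↭⇒SameChooseCounts ρ P? resp k) (↭⇒SameChooseCounts σ P? resp k)

module _ {R : Pred A q} where

  count-choose-outside : {P : Pred (List A) p} (P? : Decidable P) → (∀ {es} → P es → All R es) →
    ∀ k {ys} → All (∁ R) ys → count P? (choose (suc k) ys) ≡ 0
  count-choose-outside P? P⇒R k {[]}     []          = refl
  count-choose-outside P? P⇒R k {y ∷ ys} (¬Ry ∷ ¬Rys) = begin
    count P? (choose (suc k) (y ∷ ys))
      ≡⟨ count-choose-∷ P? k y ys ⟩
    count (P? ∘ (y ∷_)) (choose k ys) + count P? (choose (suc k) ys)
      ≡⟨ cong₂ _+_ (count-∷-excluded P? P⇒R ¬Ry (choose k ys)) (count-choose-outside P? P⇒R k ¬Rys) ⟩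
    0 ∎
    where open ≡-Reasoning

  count-choose-++-≡ˡ : {P : Pred (List A) p} (P? : Decidable P) → (∀ {es} → P es → All R es) →
    ∀ k xs {ys} → All (∁ R) ys → count P? (choose k (xs ++ ys)) ≡ count P? (choose k xs)
  count-choose-++-≡ˡ P? P⇒R zero    xs       ¬Rys = refl
  count-choose-++-≡ˡ P? P⇒R (suc k) []       ¬Rys = count-choose-outside P? P⇒R k ¬Rys
  count-choose-++-≡ˡ P? P⇒R (suc k) (x ∷ xs) {ys} ¬Rys = begin
    count P? (choose (suc k) (x ∷ xs ++ ys))
      ≡⟨ count-choose-∷ P? k x (xs ++ ys) ⟩
    count (P? ∘ (x ∷_)) (choose k (xs ++ ys)) + count P? (choose (suc k) (xs ++ ys))
      ≡⟨ cong₂ _+_ (count-choose-++-≡ˡ (P? ∘ (x ∷_)) (All.tail ∘ P⇒R) k xs ¬Rys)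
                   (count-choose-++-≡ˡ P? P⇒R (suc k) xs ¬Rys) ⟩
    count (P? ∘ (x ∷_)) (choose k xs) + count P? (choose (suc k) xs)
      ≡⟨ count-choose-∷ P? k x xs ⟨
    count P? (choose (suc k) (x ∷ xs)) ∎
    where open ≡-Reasoning

  count-choose-++-≤ : {P : Pred (List A) p} (P? : Decidable P) → (∀ {x es} → R x → P (x ∷ es) → All R es) →
    ∀ k {xs ys} → All R xs → All (∁ R) ys → count P? (choose k (xs ++ ys)) ≤ count P? (choose k xs) + count P? (choose k ys)
  count-choose-++-≤ P? hyp zero    _              _    = m≤m+n _ _
  count-choose-++-≤ P? hyp (suc k) {[]}           _    _    = ≤-refl
  count-choose-++-≤ P? hyp (suc k) {x ∷ xs} {ys} (Rx ∷ Rxs) ¬Rys = begin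
    count P? (choose (suc k) (x ∷ xs ++ ys))
      ≡⟨ count-choose-∷ P? k x (xs ++ ys) ⟩
    count (P? ∘ (x ∷_)) (choose k (xs ++ ys)) + count P? (choose (suc k) (xs ++ ys))
      ≤⟨ +-mono-≤ (≤-reflexive (count-choose-++-≡ˡ (P? ∘ (x ∷_)) (hyp Rx) k xs ¬Rys))
                  (count-choose-++-≤ P? hyp (suc k) Rxs ¬Rys) ⟩
    count (P? ∘ (x ∷_)) (choose k xs) + (count P? (choose (suc k) xs) + count P? (choose (suc k) ys))
      ≡⟨ +-assoc (count (P? ∘ (x ∷_)) (choose k xs)) _ _ ⟨
    count (P? ∘ (x ∷_)) (choose k xs) + count P? (choose (suc k) xs) + count P? (choose (suc k) ys)
      ≡⟨ cong (_+ _) (count-choose-∷ P? k x xs) ⟨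
    count P? (choose (suc k) (x ∷ xs)) + count P? (choose (suc k) ys) ∎
    where open ≤-Reasoning

  count-choose-++-≤-singleˡ : {P : Pred (List A) p} (P? : Decidable P) →
    (∀ {x y es} → R x → R y → P (x ∷ y ∷ es) → All R es) →
    ∀ k {xs ys} → All R xs → All (∁ R) ys →
    count P? (choose (suc k) (xs ++ ys))
      ≤ count P? (choose (suc k) xs) + count P? (choose (suc k) ys)
        + sum (map (λ x → count (P? ∘ (x ∷_)) (choose k ys)) xs)
  count-choose-++-≤-singleˡ P? hyp k {[]}     _          _    = ≤-reflexive (sym (+-identityʳ _))
  count-choose-++-≤-singleˡ P? hyp k {x ∷ xs} {ys} (Rx ∷ Rxs) ¬Rys = begin
    count P? (choose (suc k) (x ∷ xs ++ ys))
      ≡⟨ count-choose-∷ P? k x (xs ++ ys) ⟩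
    count (P? ∘ (x ∷_)) (choose k (xs ++ ys)) + count P? (choose (suc k) (xs ++ ys))
      ≤⟨ +-mono-≤ (count-choose-++-≤ (P? ∘ (x ∷_)) (hyp Rx) k Rxs ¬Rys)
                  (count-choose-++-≤-singleˡ P? hyp k Rxs ¬Rys) ⟩
    (c₁ˡ + c₁ʳ) + (cˡ + cʳ + s)
      ≡⟨ solve 5 (λ c₁ˡ c₁ʳ cˡ cʳ s → (c₁ˡ :+ c₁ʳ) :+ (cˡ :+ cʳ :+ s) := (c₁ˡ :+ cˡ) :+ cʳ :+ (c₁ʳ :+ s))
                 refl c₁ˡ c₁ʳ cˡ cʳ s ⟩
    (c₁ˡ + cˡ) + cʳ + (c₁ʳ + s)
      ≡⟨ cong (λ c → c + cʳ + (c₁ʳ + s)) (count-choose-∷ P? k x xs) ⟨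
    count P? (choose (suc k) (x ∷ xs)) + cʳ + (c₁ʳ + s) ∎
    where
      open ≤-Reasoning
      c₁ˡ c₁ʳ cˡ cʳ s : ℕ
      c₁ˡ = count (P? ∘ (x ∷_)) (choose k xs)
      c₁ʳ = count (P? ∘ (x ∷_)) (choose k ys)
      cˡ  = count P? (choose (suc k) xs)
      cʳ  = count P? (choose (suc k) ys)
      s   = sum (map (λ x → count (P? ∘ (x ∷_)) (choose k ys)) xs)

module _ {Q : Pred A q} (Q? : Decidable Q) where

  count-choose-≤-C : {P : Pred (List A) p} (P? : Decidable P) → (∀ {es} → P es → All Q es) →
    ∀ k xs → count P? (choose k xs) ≤ count Q? xs C k
  count-choose-≤-C P? P⇒Q zero    xs       = length-filter P? (choose 0 xs)
  count-choose-≤-C P? P⇒Q (suc k) []       = z≤n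
  count-choose-≤-C P? P⇒Q (suc k) (x ∷ xs) with Q? x
  ... | yes _ = begin
    count P? (choose (suc k) (x ∷ xs))
      ≡⟨ count-choose-∷ P? k x xs ⟩
    count (P? ∘ (x ∷_)) (choose k xs) + count P? (choose (suc k) xs)
      ≤⟨ +-mono-≤ (count-choose-≤-C (P? ∘ (x ∷_)) (All.tail ∘ P⇒Q) k xs) (count-choose-≤-C P? P⇒Q (suc k) xs) ⟩
    count Q? xs C k + count Q? xs C suc k
      ≡⟨ nCk+nC[k+1]≡[n+1]C[k+1] (count Q? xs) k ⟩
    suc (count Q? xs) C suc k ∎
    where open ≤-Reasoning
  ... | no ¬Qx = begin
    count P? (choose (suc k) (x ∷ xs))
      ≡⟨ count-choose-∷ P? k x xs ⟩
    count (P? ∘ (x ∷_)) (choose k xs) + count P? (choose (suc k) xs)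
      ≡⟨ cong (_+ _) (count-∷-excluded P? P⇒Q ¬Qx (choose k xs)) ⟩
    count P? (choose (suc k) xs)
      ≤⟨ count-choose-≤-C P? P⇒Q (suc k) xs ⟩
    count Q? xs C suc k ∎
    where open ≤-Reasoning

module _ {f g : A → ℕ} where

  sum-map-mono-≤ : ∀ {xs} → All (λ x → f x ≤ g x) xs → sum (map f xs) ≤ sum (map g xs)
  sum-map-mono-≤ []         = z≤n
  sum-map-mono-≤ (fx≤gx ∷ h) = +-mono-≤ fx≤gx (sum-map-mono-≤ h)

*-distribˡ-sum-map : ∀ c (f : A → ℕ) xs → c * sum (map f xs) ≡ sum (map (λ x → c * f x) xs)
*-distribˡ-sum-map c f []       = *-zeroʳ c
*-distribˡ-sum-map c f (x ∷ xs) = ≡-trans (*-distribˡ-+ c (f x) _) (cong (c * f x +_) (*-distribˡ-sum-map c f xs))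

sum-map-≤-length* : ∀ {f : A → ℕ} {c xs} → All (λ x → f x ≤ c) xs → sum (map f xs) ≤ length xs * c
sum-map-≤-length* []          = z≤n
sum-map-≤-length* (fx≤c ∷ h) = +-mono-≤ fx≤c (sum-map-≤-length* h)

module _ {R : REL A B p} (R? : Decidable₂ R) where

  sum-map-count-comm : ∀ xs ys → sum (map (λ x → count (R? x) ys) xs) ≡ sum (map (λ y → count (flip R? y) xs) ys)
  sum-map-count-comm []       ys = sym (zeros ys)
    where
      zeros : ∀ ys → sum (map (λ y → count (flip R? y) []) ys) ≡ 0
      zeros []       = refl
      zeros (y ∷ ys) = zeros ys
  sum-map-count-comm (x ∷ xs) ys = ≡-trans (cong (count (R? x) ys +_) (sum-map-count-comm xs ys)) (sym (split ys))
    where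
      split : ∀ ys → sum (map (λ y → count (flip R? y) (x ∷ xs)) ys)
                     ≡ count (R? x) ys + sum (map (λ y → count (flip R? y) xs) ys)
      split []       = refl
      split (y ∷ ys) with R? x y
      ... | yes _ = cong suc (≡-trans (cong (_ +_) (split ys)) (ℕ-CS.x∙yz≈y∙xz (count (flip R? y) xs) (count (R? x) ys) _))
      ... | no _  = ≡-trans (cong (_ +_) (split ys)) (ℕ-CS.x∙yz≈y∙xz (count (flip R? y) xs) (count (R? x) ys) _)

-- Binomial coefficients

C-monoˡ-≤ : ∀ {m n} k → m ≤ n → m C k ≤ n C k
C-monoˡ-≤ zero    _         = ≤-refl
C-monoˡ-≤ (suc k) z≤n       = z≤n
C-monoˡ-≤ {suc m} {suc n} (suc k) (s≤s m≤n) = begin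
  suc m C suc k           ≡⟨ nCk+nC[k+1]≡[n+1]C[k+1] m k ⟨
  m C k + m C suc k       ≤⟨ +-mono-≤ (C-monoˡ-≤ k m≤n) (C-monoˡ-≤ (suc k) m≤n) ⟩
  n C k + n C suc k       ≡⟨ nCk+nC[k+1]≡[n+1]C[k+1] n k ⟩
  suc n C suc k           ∎
  where open ≤-Reasoning

[k+1]*[n+1]C[k+1]≡[n+1]*nCk : ∀ n k → suc k * (suc n C suc k) ≡ suc n * (n C k)
[k+1]*[n+1]C[k+1]≡[n+1]*nCk zero    zero    = refl
[k+1]*[n+1]C[k+1]≡[n+1]*nCk zero    (suc k) = *-zeroʳ (2 + k)
[k+1]*[n+1]C[k+1]≡[n+1]*nCk (suc n) zero    =
  ≡-trans (*-identityˡ _) (≡-trans (nC1≡n (2 + n)) (sym (*-identityʳ (2 + n))))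
[k+1]*[n+1]C[k+1]≡[n+1]*nCk (suc n) (suc k) = begin
  (2 + k) * ((2 + n) C (2 + k))
    ≡⟨ cong ((2 + k) *_) (nCk+nC[k+1]≡[n+1]C[k+1] (suc n) (suc k)) ⟨
  (2 + k) * ((1 + n) C (1 + k) + (1 + n) C (2 + k))
    ≡⟨ *-distribˡ-+ (2 + k) ((1 + n) C (1 + k)) _ ⟩
  (1 + n) C (1 + k) + (1 + k) * ((1 + n) C (1 + k)) + (2 + k) * ((1 + n) C (2 + k))
    ≡⟨ cong₂ (λ u v → (1 + n) C (1 + k) + u + v) ([k+1]*[n+1]C[k+1]≡[n+1]*nCk n k)
                                                 ([k+1]*[n+1]C[k+1]≡[n+1]*nCk n (suc k)) ⟩
  (1 + n) C (1 + k) + (1 + n) * (n C k) + (1 + n) * (n C (1 + k))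
    ≡⟨ +-assoc ((1 + n) C (1 + k)) _ _ ⟩
  (1 + n) C (1 + k) + ((1 + n) * (n C k) + (1 + n) * (n C (1 + k)))
    ≡⟨ cong ((1 + n) C (1 + k) +_) (*-distribˡ-+ (1 + n) (n C k) _) ⟨
  (1 + n) C (1 + k) + (1 + n) * (n C k + n C (1 + k))
    ≡⟨ cong (λ c → (1 + n) C (1 + k) + (1 + n) * c) (nCk+nC[k+1]≡[n+1]C[k+1] n k) ⟩
  (2 + n) * ((1 + n) C (1 + k)) ∎
  where open ≡-Reasoning

[k+1]*nC[k+1]≡n*[n∸1]Ck : ∀ n k → suc k * (n C suc k) ≡ n * ((n ∸ 1) C k)
[k+1]*nC[k+1]≡n*[n∸1]Ck zero    k = *-zeroʳ (suc k)
[k+1]*nC[k+1]≡n*[n∸1]Ck (suc n) k = [k+1]*[n+1]C[k+1]≡[n+1]*nCk n k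

[n+1]Cn≡n+1 : ∀ n → suc n C n ≡ suc n
[n+1]Cn≡n+1 n = begin
  suc n C n               ≡⟨ nCk≡nC[n∸k] (n≤1+n n) ⟩
  suc n C (suc n ∸ n)     ≡⟨ cong (suc n C_) (m+n∸n≡m 1 n) ⟩
  suc n C 1               ≡⟨ nC1≡n (suc n) ⟩
  suc n                   ∎
  where open ≡-Reasoning

-- Subsets of [m + 1] seen from a vertex

∣p∩q∣≡∣p∣⇒p⊆q : ∀ {n} (p q : Subset n) → ∣ p ∩ q ∣ ≡ ∣ p ∣ → p ⊆ q
∣p∩q∣≡∣p∣⇒p⊆q []            []            _  = λ ()
∣p∩q∣≡∣p∣⇒p⊆q (outside ∷ p) (_ ∷ q)       eq = out⊆ (∣p∩q∣≡∣p∣⇒p⊆q p q eq)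
∣p∩q∣≡∣p∣⇒p⊆q (inside ∷ p)  (inside ∷ q)  eq = in⊆in (∣p∩q∣≡∣p∣⇒p⊆q p q (suc-injective eq))
∣p∩q∣≡∣p∣⇒p⊆q (inside ∷ p)  (outside ∷ q) eq = contradiction eq (<⇒≢ (s≤s (∣p∩q∣≤∣p∣ p q)))

subset-of-size : ∀ (e : Subset n) {t} → t ≤ ∣ e ∣ → Σ (Subset n) (λ T → T ⊆ e × ∣ T ∣ ≡ t)
subset-of-size {n} e {zero} _ = ⊥ , ⊥⊆ , ∣⊥∣≡0 n
subset-of-size (inside ∷ e) {suc t} (s≤s t≤∣e∣) with T , T⊆e , ∣T∣ ← subset-of-size e t≤∣e∣ =
  inside ∷ T , in⊆in T⊆e , cong suc ∣T∣
subset-of-size (outside ∷ e) {suc t} t<∣e∣ with T , T⊆e , ∣T∣ ← subset-of-size e t<∣e∣ =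
  outside ∷ T , out⊆ T⊆e , ∣T∣

-- The subset of [m + 1] that contains i iff b and meets [m + 1] ∖ {i} ≅ [m] in s.
extend : Fin (suc m) → Side → Subset m → Subset (suc m)
extend i b s = insertAt s i b

i∈extend-inside : ∀ (i : Fin (suc m)) s → i ∈ extend i inside s
i∈extend-inside zero    s       = here
i∈extend-inside (suc i) (_ ∷ s) = there (i∈extend-inside i s)

i∉extend-outside : ∀ (i : Fin (suc m)) s → i ∉ extend i outside s
i∉extend-outside (suc i) (_ ∷ s) (there i∈) = i∉extend-outside i s i∈

does-i∈?-extend : ∀ (i : Fin (suc m)) b s → does (i ∈? extend i b s) ≡ b
does-i∈?-extend i inside  s = dec-true  (i ∈? _) (i∈extend-inside i s)
does-i∈?-extend i outside s = dec-false (i ∈? _) (i∉extend-outside i s)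

∣extend-inside∣ : ∀ (i : Fin (suc m)) s → ∣ extend i inside s ∣ ≡ suc ∣ s ∣
∣extend-inside∣ zero    s             = refl
∣extend-inside∣ (suc i) (inside  ∷ s) = cong suc (∣extend-inside∣ i s)
∣extend-inside∣ (suc i) (outside ∷ s) = ∣extend-inside∣ i s

∣extend-outside∣ : ∀ (i : Fin (suc m)) s → ∣ extend i outside s ∣ ≡ ∣ s ∣
∣extend-outside∣ zero    s             = refl
∣extend-outside∣ (suc i) (inside  ∷ s) = cong suc (∣extend-outside∣ i s)
∣extend-outside∣ (suc i) (outside ∷ s) = ∣extend-outside∣ i s

extend-∩ : ∀ (i : Fin (suc m)) b c s t → extend i b s ∩ extend i c t ≡ extend i (b ∧ c) (s ∩ t)
extend-∩ zero    b c s       t       = refl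
extend-∩ (suc i) b c (x ∷ s) (y ∷ t) = cong (x ∧ y ∷_) (extend-∩ i b c s t)

extend-injective : ∀ (i : Fin (suc m)) {b c s t} → extend i b s ≡ extend i c t → s ≡ t
extend-injective i {b} {c} {s} {t} eq = begin
  s                          ≡⟨ removeAt-insertAt s i b ⟨
  removeAt (extend i b s) i  ≡⟨ cong (λ u → removeAt u i) eq ⟩
  removeAt (extend i c t) i  ≡⟨ removeAt-insertAt t i c ⟩
  t                          ∎
  where open ≡-Reasoning

extend-⊆⁻ : ∀ (i : Fin (suc m)) {b c s t} → extend i b s ⊆ extend i c t → s ⊆ t
extend-⊆⁻ zero                                   h = drop-∷-⊆ h
extend-⊆⁻ (suc i) {s = outside ∷ s} {_ ∷ t}       h = out⊆ (extend-⊆⁻ i (drop-∷-⊆ h))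
extend-⊆⁻ (suc i) {s = inside ∷ s} {inside ∷ t}   h = in⊆in (extend-⊆⁻ i (drop-∷-⊆ h))
extend-⊆⁻ (suc i) {s = inside ∷ s} {outside ∷ t}  h with () ← h here

extend-outside-⊆⁺ : ∀ (i : Fin (suc m)) {c s t} → s ⊆ t → extend i outside s ⊆ extend i c t
extend-outside-⊆⁺ zero                                   h = out⊆ h
extend-outside-⊆⁺ (suc i) {s = outside ∷ s} {_ ∷ t}       h = out⊆ (extend-outside-⊆⁺ i (drop-∷-⊆ h))
extend-outside-⊆⁺ (suc i) {s = inside ∷ s} {inside ∷ t}   h = in⊆in (extend-outside-⊆⁺ i (drop-∷-⊆ h))
extend-outside-⊆⁺ (suc i) {s = inside ∷ s} {outside ∷ t}  h with () ← h here

extend-outside-∪⁅i⁆ : ∀ (i : Fin (suc m)) s → extend i outside s ∪ ⁅ i ⁆ ≡ extend i inside s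
extend-outside-∪⁅i⁆ zero    s       = cong (inside ∷_) (∪-identityʳ s)
extend-outside-∪⁅i⁆ (suc i) (x ∷ s) = cong₂ _∷_ (∨-identityʳ x) (extend-outside-∪⁅i⁆ i s)

allSubsets-↭-extend : ∀ (i : Fin (suc m)) →
  allSubsets (suc m) ↭ map (extend i inside) (allSubsets m) ++ map (extend i outside) (allSubsets m)
allSubsets-↭-extend zero = refl
allSubsets-↭-extend {suc m} (suc i) = begin
  map (inside ∷_) (allSubsets (suc m)) ++ map (outside ∷_) (allSubsets (suc m))
    ↭⟨ ↭-++⁺ (↭-map⁺ (inside ∷_) split) (↭-map⁺ (outside ∷_) split) ⟩
  map (inside ∷_) (ins ++ outs) ++ map (outside ∷_) (ins ++ outs)
    ≡⟨ cong₂ _++_ (map-++ (inside ∷_) ins outs) (map-++ (outside ∷_) ins outs) ⟩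
  (map (inside ∷_) ins ++ map (inside ∷_) outs) ++ (map (outside ∷_) ins ++ map (outside ∷_) outs)
    ↭⟨ ↭-CS.interchange (map (inside ∷_) ins) _ _ _ ⟩
  (map (inside ∷_) ins ++ map (outside ∷_) ins) ++ (map (inside ∷_) outs ++ map (outside ∷_) outs)
    ≡⟨ cong₂ _++_ (map-extend-suc inside) (map-extend-suc outside) ⟩
  map (extend (suc i) inside) (allSubsets (suc m)) ++ map (extend (suc i) outside) (allSubsets (suc m)) ∎
  where
    open PermutationReasoning
    module ↭-CS = CommSemigroupProperties (CommutativeMonoid.commutativeSemigroup ++-commutativeMonoid)
    split : allSubsets (suc m) ↭ map (extend i inside) (allSubsets m) ++ map (extend i outside) (allSubsets m)
    split = allSubsets-↭-extend i
    ins outs : List (Subset (suc m))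
    ins  = map (extend i inside) (allSubsets m)
    outs = map (extend i outside) (allSubsets m)
    map-∷-extend : ∀ x b → map (x ∷_) (map (extend i b) (allSubsets m)) ≡ map (extend (suc i) b) (map (x ∷_) (allSubsets m))
    map-∷-extend x b = ≡-trans (sym (map-∘ {g = x ∷_} {f = extend i b} (allSubsets m)))
                               (map-∘ {g = extend (suc i) b} {f = x ∷_} (allSubsets m))
    map-extend-suc : ∀ b → map (inside ∷_) (map (extend i b) (allSubsets m)) ++ map (outside ∷_) (map (extend i b) (allSubsets m))
                           ≡ map (extend (suc i) b) (allSubsets (suc m))
    map-extend-suc b = ≡-trans (cong₂ _++_ (map-∷-extend inside b) (map-∷-extend outside b))
                               (sym (map-++ (extend (suc i) b) (map (inside ∷_) (allSubsets m)) _))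

count-allSubsets-suc : {P : Pred (Subset (suc m)) p} (P? : Decidable P) →
  count P? (allSubsets (suc m)) ≡ count (P? ∘ (inside ∷_)) (allSubsets m) + count (P? ∘ (outside ∷_)) (allSubsets m)
count-allSubsets-suc {m} P? = ≡-trans (count-++ P? (map (inside ∷_) (allSubsets m)) _)
  (cong₂ _+_ (count-map P? (inside ∷_) (allSubsets m)) (count-map P? (outside ∷_) (allSubsets m)))

sizedSubset? : ∀ j (c : Subset m) → Decidable (λ s → ∣ s ∣ ≡ j × s ⊆ c)
sizedSubset? j c s = ∣ s ∣ ≟ j ×-dec s ⊆? c

sizedSuperset? : ∀ j (a : Subset m) → Decidable (λ s → ∣ s ∣ ≡ j × a ⊆ s)
sizedSuperset? j a s = ∣ s ∣ ≟ j ×-dec a ⊆? s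

count-sizedSubsets : ∀ j (c : Subset m) → count (sizedSubset? j c) (allSubsets m) ≡ ∣ c ∣ C j
count-sizedSubsets zero    []           = refl
count-sizedSubsets (suc j) []           = refl
count-sizedSubsets {suc m} zero (inside ∷ c) = begin
  count (sizedSubset? 0 (inside ∷ c)) (allSubsets (suc m))
      ≡⟨ count-allSubsets-suc (sizedSubset? 0 (inside ∷ c)) ⟩
  count (sizedSubset? 0 (inside ∷ c) ∘ (inside ∷_)) (allSubsets m)
    + count (sizedSubset? 0 (inside ∷ c) ∘ (outside ∷_)) (allSubsets m)
      ≡⟨ cong₂ _+_ (count-none (sizedSubset? 0 (inside ∷ c) ∘ (inside ∷_)) (All.universal (λ _ → λ ()) (allSubsets m)))
                   (count-cong _ (sizedSubset? 0 c) (λ _ → refl) (allSubsets m)) ⟩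
  count (sizedSubset? 0 c) (allSubsets m)
      ≡⟨ count-sizedSubsets 0 c ⟩
  1 ∎
  where open ≡-Reasoning
count-sizedSubsets {suc m} (suc j) (inside ∷ c) = begin
  count (sizedSubset? (suc j) (inside ∷ c)) (allSubsets (suc m))
      ≡⟨ count-allSubsets-suc (sizedSubset? (suc j) (inside ∷ c)) ⟩
  count (sizedSubset? (suc j) (inside ∷ c) ∘ (inside ∷_)) (allSubsets m)
    + count (sizedSubset? (suc j) (inside ∷ c) ∘ (outside ∷_)) (allSubsets m)
      ≡⟨ cong₂ _+_ (count-cong _ (sizedSubset? j c) (λ _ → refl) (allSubsets m))
                   (count-cong _ (sizedSubset? (suc j) c) (λ _ → refl) (allSubsets m)) ⟩
  count (sizedSubset? j c) (allSubsets m) + count (sizedSubset? (suc j) c) (allSubsets m)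
      ≡⟨ cong₂ _+_ (count-sizedSubsets j c) (count-sizedSubsets (suc j) c) ⟩
  ∣ c ∣ C j + ∣ c ∣ C suc j
      ≡⟨ nCk+nC[k+1]≡[n+1]C[k+1] ∣ c ∣ j ⟩
  suc ∣ c ∣ C suc j ∎
  where open ≡-Reasoning
count-sizedSubsets {suc m} j (outside ∷ c) = begin
  count (sizedSubset? j (outside ∷ c)) (allSubsets (suc m))
      ≡⟨ count-allSubsets-suc (sizedSubset? j (outside ∷ c)) ⟩
  count (sizedSubset? j (outside ∷ c) ∘ (inside ∷_)) (allSubsets m)
    + count (sizedSubset? j (outside ∷ c) ∘ (outside ∷_)) (allSubsets m)
      ≡⟨ cong₂ _+_ (count-none (sizedSubset? j (outside ∷ c) ∘ (inside ∷_))
                      (All.universal (λ _ (_ , ⊆c) → case ⊆c here of λ ()) (allSubsets m)))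
                   (count-cong _ (sizedSubset? j c) (λ _ → refl) (allSubsets m)) ⟩
  count (sizedSubset? j c) (allSubsets m)
      ≡⟨ count-sizedSubsets j c ⟩
  ∣ c ∣ C j ∎
  where open ≡-Reasoning

count-sizedSupersets : ∀ j (a : Subset m) → count (sizedSuperset? (j + ∣ a ∣) a) (allSubsets m) ≡ (m ∸ ∣ a ∣) C j
count-sizedSupersets zero    [] = refl
count-sizedSupersets (suc j) [] = refl
count-sizedSupersets {suc m} j (inside ∷ a) = begin
  count (sizedSuperset? (j + suc ∣ a ∣) (inside ∷ a)) (allSubsets (suc m))
      ≡⟨ count-allSubsets-suc (sizedSuperset? (j + suc ∣ a ∣) (inside ∷ a)) ⟩
  count (sizedSuperset? (j + suc ∣ a ∣) (inside ∷ a) ∘ (inside ∷_)) (allSubsets m)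
    + count (sizedSuperset? (j + suc ∣ a ∣) (inside ∷ a) ∘ (outside ∷_)) (allSubsets m)
      ≡⟨ cong₂ _+_ (count-cong _ (sizedSuperset? (j + ∣ a ∣) a)
                      (λ s → cong (λ n → does (suc ∣ s ∣ ≟ n) ∧ does (a ⊆? s)) (+-suc j ∣ a ∣)) (allSubsets m))
                   (count-none (sizedSuperset? (j + suc ∣ a ∣) (inside ∷ a) ∘ (outside ∷_))
                      (All.universal (λ _ (_ , a⊆) → case a⊆ here of λ ()) (allSubsets m))) ⟩
  count (sizedSuperset? (j + ∣ a ∣) a) (allSubsets m) + 0
      ≡⟨ +-identityʳ _ ⟩
  count (sizedSuperset? (j + ∣ a ∣) a) (allSubsets m)
      ≡⟨ count-sizedSupersets j a ⟩
  (m ∸ ∣ a ∣) C j ∎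
  where open ≡-Reasoning
count-sizedSupersets {suc m} zero (outside ∷ a) = begin
  count (sizedSuperset? ∣ a ∣ (outside ∷ a)) (allSubsets (suc m))
      ≡⟨ count-allSubsets-suc (sizedSuperset? ∣ a ∣ (outside ∷ a)) ⟩
  count (sizedSuperset? ∣ a ∣ (outside ∷ a) ∘ (inside ∷_)) (allSubsets m)
    + count (sizedSuperset? ∣ a ∣ (outside ∷ a) ∘ (outside ∷_)) (allSubsets m)
      ≡⟨ cong₂ _+_ (count-none (sizedSuperset? ∣ a ∣ (outside ∷ a) ∘ (inside ∷_))
                      (All.universal too-small (allSubsets m)))
                   (count-cong _ (sizedSuperset? ∣ a ∣ a) (λ _ → refl) (allSubsets m)) ⟩
  count (sizedSuperset? ∣ a ∣ a) (allSubsets m)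
      ≡⟨ count-sizedSupersets 0 a ⟩
  1 ∎
  where
    open ≡-Reasoning
    too-small : ∀ s → ¬ (suc ∣ s ∣ ≡ ∣ a ∣ × outside ∷ a ⊆ inside ∷ s)
    too-small s (eq , a⊆s) = <-irrefl (sym eq) (s≤s (p⊆q⇒∣p∣≤∣q∣ (drop-∷-⊆ a⊆s)))
count-sizedSupersets {suc m} (suc j) (outside ∷ a) = begin
  count (sizedSuperset? (suc j + ∣ a ∣) (outside ∷ a)) (allSubsets (suc m))
      ≡⟨ count-allSubsets-suc (sizedSuperset? (suc j + ∣ a ∣) (outside ∷ a)) ⟩
  count (sizedSuperset? (suc j + ∣ a ∣) (outside ∷ a) ∘ (inside ∷_)) (allSubsets m)
    + count (sizedSuperset? (suc j + ∣ a ∣) (outside ∷ a) ∘ (outside ∷_)) (allSubsets m)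
      ≡⟨ cong₂ _+_ (count-cong _ (sizedSuperset? (j + ∣ a ∣) a) (λ _ → refl) (allSubsets m))
                   (count-cong _ (sizedSuperset? (suc j + ∣ a ∣) a) (λ _ → refl) (allSubsets m)) ⟩
  count (sizedSuperset? (j + ∣ a ∣) a) (allSubsets m) + count (sizedSuperset? (suc j + ∣ a ∣) a) (allSubsets m)
      ≡⟨ cong₂ _+_ (count-sizedSupersets j a) (count-sizedSupersets (suc j) a) ⟩
  (m ∸ ∣ a ∣) C j + (m ∸ ∣ a ∣) C suc j
      ≡⟨ nCk+nC[k+1]≡[n+1]C[k+1] (m ∸ ∣ a ∣) j ⟩
  suc (m ∸ ∣ a ∣) C suc j
      ≡⟨ cong (_C suc j) (+-∸-assoc 1 (∣p∣≤n a)) ⟨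
  (suc m ∸ ∣ a ∣) C suc j ∎
  where open ≡-Reasoning

-- Sunflowers

private
  module ↭ₛ {n : ℕ} = ↭ₛ-Properties (setoid (Subset n))

IsSunflower-resp-↭ : ∀ {r t} → IsSunflower {n} r t Respects _↭_
IsSunflower-resp-↭ ρ (sizes , T , ∣T∣ , T⊆ , pairs) =
  All-resp-↭ ρ sizes , T , ∣T∣ , All-resp-↭ ρ T⊆ ,
  ↭ₛ.AllPairs-resp-↭ (λ {x} {y} → ≡-trans (∩-comm y x)) (resp₂ _) (↭⇒↭ₛ ρ) pairs

sunflower-singleton : ∀ {e : Subset n} {r t} → ∣ e ∣ ≡ r → t ≤ r → IsSunflower r t (e ∷ [])
sunflower-singleton {e = e} refl t≤r with T , T⊆e , ∣T∣ ← subset-of-size e t≤r =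
  (refl ∷ []) , T , ∣T∣ , (T⊆e ∷ []) , ([] ∷ [])

sunflower-core-∈ : ∀ {r t x y es} {v : Fin n} → IsSunflower r t (x ∷ y ∷ es) → v ∈ x → v ∈ y → All (v ∈_) es
sunflower-core-∈ (_ , T , _ , (_ ∷ _ ∷ T⊆es) , ((x∩y≡T ∷ _) ∷ _)) v∈x v∈y =
  All.map (λ T⊆e → T⊆e (subst (_ ∈_) x∩y≡T (x∈p∩q⁺ (v∈x , v∈y)))) T⊆es

sunflower-remove-vertex : ∀ (i : Fin (suc m)) {r t} a b es →
  IsSunflower (suc r) (suc t) (map (extend i inside) (a ∷ b ∷ es)) →
  IsSunflower r t (map (extend i outside) (a ∷ b ∷ es))
sunflower-remove-vertex i a b es (sizes , T , ∣T∣ , T⊆ , pairs@((a∩b≡T ∷ _) ∷ _)) =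
  All.map⁺ (All.map shrink (All.map⁻ sizes)) ,
  extend i outside (a ∩ b) ,
  shrink (≡-trans (cong ∣_∣ (sym T≡)) ∣T∣) ,
  All.map⁺ (All.map core⊆ (All.map⁻ T⊆)) ,
  AllPairs.map⁺ (AllPairs.map meet (AllPairs.map⁻ pairs))
  where
    T≡ : T ≡ extend i inside (a ∩ b)
    T≡ = ≡-trans (sym a∩b≡T) (extend-∩ i inside inside a b)
    shrink : ∀ {s k} → ∣ extend i inside s ∣ ≡ suc k → ∣ extend i outside s ∣ ≡ k
    shrink {s} eq = ≡-trans (∣extend-outside∣ i s) (suc-injective (≡-trans (sym (∣extend-inside∣ i s)) eq))
    core⊆ : ∀ {s} → T ⊆ extend i inside s → extend i outside (a ∩ b) ⊆ extend i outside s
    core⊆ T⊆s = extend-outside-⊆⁺ i (extend-⊆⁻ i (subst (_⊆ _) T≡ T⊆s))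
    meet : ∀ {s s′} → extend i inside s ∩ extend i inside s′ ≡ T →
           extend i outside s ∩ extend i outside s′ ≡ extend i outside (a ∩ b)
    meet {s} {s′} eq = ≡-trans (extend-∩ i outside outside s s′)
      (cong (extend i outside) (extend-injective i (≡-trans (sym (extend-∩ i inside inside s s′)) (≡-trans eq T≡))))

sunflower-petals-⊇ : ∀ (i : Fin (suc m)) {r} a cs →
  IsSunflower (suc r) r (extend i inside a ∷ map (extend i outside) cs) → All (a ⊆_) cs
sunflower-petals-⊇ i {r} a cs ((∣a∣ ∷ _) , T , ∣T∣ , _ , (a∩cs≡T ∷ _)) = All.map petal (All.map⁻ a∩cs≡T)
  where
    petal : ∀ {c} → extend i inside a ∩ extend i outside c ≡ T → a ⊆ c
    petal {c} eq = ∣p∩q∣≡∣p∣⇒p⊆q a c (begin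
      ∣ a ∩ c ∣                     ≡⟨ ∣extend-outside∣ i (a ∩ c) ⟨
      ∣ extend i outside (a ∩ c) ∣  ≡⟨ cong ∣_∣ (≡-trans (sym (extend-∩ i inside outside a c)) eq) ⟩
      ∣ T ∣                         ≡⟨ ∣T∣ ⟩
      r                             ≡⟨ suc-injective (≡-trans (sym (∣extend-inside∣ i a)) ∣a∣) ⟨
      ∣ a ∣                         ∎)
      where open ≡-Reasoning

-- Splitting a hypergraph at a vertex

isEdge? : (G : Hypergraph n) → Decidable (λ e → G e ≡ true)
isEdge? G e = G e Bool.≟ true

-- slice H i inside is the link of i and slice H i outside is H - {i},
-- both as hypergraphs on [m + 1] ∖ {i} ≅ [m].
slice : Hypergraph (suc m) → Fin (suc m) → Side → Hypergraph m
slice H i b = H ∘ extend i b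

edges-uniform : ∀ {r} {G : Hypergraph n} → Uniform r G → All (λ e → ∣ e ∣ ≡ r) (edges G)
edges-uniform {G = G} U = All.map (U _) (All.all-filter (isEdge? G) (allSubsets _))

Uniform-slice-inside : ∀ {r} {H : Hypergraph (suc m)} i → Uniform (suc r) H → Uniform r (slice H i inside)
Uniform-slice-inside i U s Hs = suc-injective (≡-trans (sym (∣extend-inside∣ i s)) (U _ Hs))

Uniform-slice-outside : ∀ {r} {H : Hypergraph (suc m)} i → Uniform r H → Uniform r (slice H i outside)
Uniform-slice-outside i U s Hs = ≡-trans (sym (∣extend-outside∣ i s)) (U _ Hs)

edges-cong : {G G′ : Hypergraph n} → (∀ e → G e ≡ G′ e) → edges G ≡ edges G′
edges-cong {G = G} {G′} G≗G′ = filter-≐ (isEdge? G) (isEdge? G′)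
  ((λ {e} → ≡-trans (sym (G≗G′ e))) , (λ {e} → ≡-trans (G≗G′ e))) (allSubsets _)

edges-empty : {G : Hypergraph n} → (∀ e → G e ≡ false) → edges G ≡ []
edges-empty {G = G} G≡false = filter-none (isEdge? G)
  (All.universal (λ e Ge → case ≡-trans (sym (G≡false e)) Ge of λ ()) (allSubsets _))

edges-↭-extend : ∀ (G : Hypergraph (suc m)) i →
  edges G ↭ map (extend i inside) (edges (slice G i inside)) ++ map (extend i outside) (edges (slice G i outside))
edges-↭-extend {m} G i = begin
  filter (isEdge? G) (allSubsets (suc m))
    ↭⟨ filter-↭ (isEdge? G) (allSubsets-↭-extend i) ⟩
  filter (isEdge? G) (map (extend i inside) (allSubsets m) ++ map (extend i outside) (allSubsets m))
    ≡⟨ filter-++ (isEdge? G) (map (extend i inside) (allSubsets m)) _ ⟩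
  filter (isEdge? G) (map (extend i inside) (allSubsets m)) ++ filter (isEdge? G) (map (extend i outside) (allSubsets m))
    ≡⟨ cong₂ _++_ (filter-map (isEdge? G) (extend i inside) (allSubsets m))
                  (filter-map (isEdge? G) (extend i outside) (allSubsets m)) ⟩
  map (extend i inside) (edges (slice G i inside)) ++ map (extend i outside) (edges (slice G i outside)) ∎
  where open PermutationReasoning

edges-delV : ∀ (H : Hypergraph (suc m)) i → edges (delV H i) ↭ map (extend i outside) (edges (slice H i outside))
edges-delV H i = ↭-trans (edges-↭-extend (delV H i) i)
  (↭-reflexive (cong₂ _++_ (cong (map _) (edges-empty through)) (cong (map _) (edges-cong avoiding))))
  where
    through : ∀ s → H (extend i inside s) ∧ not (does (i ∈? extend i inside s)) ≡ false
    through s = ≡-trans (cong (λ b → H (extend i inside s) ∧ not b) (does-i∈?-extend i inside s)) (∧-zeroʳ _)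
    avoiding : ∀ s → H (extend i outside s) ∧ not (does (i ∈? extend i outside s)) ≡ H (extend i outside s)
    avoiding s = ≡-trans (cong (λ b → H (extend i outside s) ∧ not b) (does-i∈?-extend i outside s)) (∧-identityʳ _)

edges-link : ∀ (H : Hypergraph (suc m)) i → edges (link H i) ↭ map (extend i outside) (edges (slice H i inside))
edges-link H i = ↭-trans (edges-↭-extend (link H i) i)
  (↭-reflexive (cong₂ _++_ (cong (map _) (edges-empty through)) (cong (map _) (edges-cong avoiding))))
  where
    through : ∀ s → not (does (i ∈? extend i inside s)) ∧ H (extend i inside s ∪ ⁅ i ⁆) ≡ false
    through s = cong (λ b → not b ∧ H (extend i inside s ∪ ⁅ i ⁆)) (does-i∈?-extend i inside s)
    avoiding : ∀ s → not (does (i ∈? extend i outside s)) ∧ H (extend i outside s ∪ ⁅ i ⁆) ≡ H (extend i inside s)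
    avoiding s = cong₂ (λ b e → not b ∧ H e) (does-i∈?-extend i outside s) (extend-outside-∪⁅i⁆ i s)

count-edges-⊆ : ∀ {s} {G : Hypergraph m} → Uniform s G → ∀ c → count (_⊆? c) (edges G) ≤ ∣ c ∣ C s
count-edges-⊆ {m} {s} {G} U c = begin
  count (_⊆? c) (filter (isEdge? G) (allSubsets m))
    ≤⟨ count-filter-mono (isEdge? G) (_⊆? c) (sizedSubset? s c)
                         (λ {e} Ge e⊆c → U e Ge , e⊆c) (allSubsets m) ⟩
  count (sizedSubset? s c) (allSubsets m)
    ≡⟨ count-sizedSubsets s c ⟩
  ∣ c ∣ C s ∎
  where open ≤-Reasoning

count-edges-⊇ : ∀ {s} {G : Hypergraph m} → Uniform (suc s) G →
  ∀ {a} → ∣ a ∣ ≡ s → count (a ⊆?_) (edges G) ≤ m ∸ s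
count-edges-⊇ {m} {G = G} U {a} refl = begin
  count (a ⊆?_) (filter (isEdge? G) (allSubsets m))
    ≤⟨ count-filter-mono (isEdge? G) (a ⊆?_) (sizedSuperset? (1 + ∣ a ∣) a)
                         (λ {e} Ge a⊆e → U e Ge , a⊆e) (allSubsets m) ⟩
  count (sizedSuperset? (1 + ∣ a ∣) a) (allSubsets m)
    ≡⟨ count-sizedSupersets 1 a ⟩
  (m ∸ ∣ a ∣) C 1
    ≡⟨ nC1≡n (m ∸ ∣ a ∣) ⟩
  m ∸ ∣ a ∣ ∎
  where open ≤-Reasoning

N-singletons : ∀ {r t} {G : Hypergraph n} → All (λ e → ∣ e ∣ ≡ r) (edges G) → t ≤ r → N r t 1 G ≡ eH G
N-singletons {r = r} {t} {G} sizes t≤r = begin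
  count (isSunflower? r t) (choose 1 (edges G))
    ≡⟨ cong (count _) (choose-1 (edges G)) ⟩
  count (isSunflower? r t) (map [_] (edges G))
    ≡⟨ count-map (isSunflower? r t) [_] (edges G) ⟩
  count (isSunflower? r t ∘ [_]) (edges G)
    ≡⟨ count-all (isSunflower? r t ∘ [_]) (All.map (λ ∣e∣ → sunflower-singleton ∣e∣ t≤r) sizes) ⟩
  eH G ∎
  where open ≡-Reasoning

module _ {m : ℕ} (H : Hypergraph (suc m)) (i : Fin (suc m)) where

  eH-delV : eH (delV H i) ≡ eH (slice H i outside)
  eH-delV = ≡-trans (↭-length (edges-delV H i)) (length-map _ (edges (slice H i outside)))

  eH-link : eH (link H i) ≡ eH (slice H i inside)
  eH-link = ≡-trans (↭-length (edges-link H i)) (length-map _ (edges (slice H i inside)))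

  eH-vertex-split : eH H ≡ eH (delV H i) + eH (link H i)
  eH-vertex-split = begin
    eH H
      ≡⟨ ↭-length (edges-↭-extend H i) ⟩
    length (map (extend i inside) (edges (slice H i inside)) ++ map (extend i outside) (edges (slice H i outside)))
      ≡⟨ length-++ (map (extend i inside) (edges (slice H i inside))) ⟩
    length (map (extend i inside) (edges (slice H i inside))) + length (map (extend i outside) (edges (slice H i outside)))
      ≡⟨ cong₂ _+_ (length-map _ (edges (slice H i inside))) (length-map _ (edges (slice H i outside))) ⟩
    eH (slice H i inside) + eH (slice H i outside)
      ≡⟨ +-comm (eH (slice H i inside)) _ ⟩
    eH (slice H i outside) + eH (slice H i inside)
      ≡⟨ cong₂ _+_ eH-delV eH-link ⟨
    eH (delV H i) + eH (link H i) ∎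
    where open ≡-Reasoning

  edges-delV-uniform : ∀ {r} → Uniform r H → All (λ e → ∣ e ∣ ≡ r) (edges (delV H i))
  edges-delV-uniform U = All-resp-↭ (↭-sym (edges-delV H i))
    (All.map⁺ (All.map (λ {s} → ≡-trans (∣extend-outside∣ i s)) (edges-uniform (Uniform-slice-outside i U))))

  edges-link-uniform : ∀ {r} → Uniform (suc r) H → All (λ e → ∣ e ∣ ≡ r) (edges (link H i))
  edges-link-uniform U = All-resp-↭ (↭-sym (edges-link H i))
    (All.map⁺ (All.map (λ {s} → ≡-trans (∣extend-outside∣ i s)) (edges-uniform (Uniform-slice-inside i U))))

N-singletons-vertex-split : ∀ {r t t′} {H : Hypergraph (suc m)} → Uniform (suc r) H → t ≤ suc r → t′ ≤ r → ∀ i →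
  N (suc r) t 1 H ≡ N (suc r) t 1 (delV H i) + N r t′ 1 (link H i)
N-singletons-vertex-split {r = r} {t} {t′} {H} U t≤1+r t′≤r i = begin
  N (suc r) t 1 H                                ≡⟨ N-singletons (edges-uniform U) t≤1+r ⟩
  eH H                                           ≡⟨ eH-vertex-split H i ⟩
  eH (delV H i) + eH (link H i)                  ≡⟨ cong₂ _+_ (N-singletons (edges-delV-uniform H i U) t≤1+r)
                                                              (N-singletons (edges-link-uniform H i U) t′≤r) ⟨
  N (suc r) t 1 (delV H i) + N r t′ 1 (link H i) ∎
  where open ≡-Reasoning

count-sunflowers-remove-vertex : ∀ (i : Fin (suc m)) {r t} j (E : List (Subset m)) →
  count (isSunflower? (suc r) (suc t)) (choose (2 + j) (map (extend i inside) E))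
    ≤ count (isSunflower? r t) (choose (2 + j) (map (extend i outside) E))
count-sunflowers-remove-vertex i {r} {t} j E = begin
  count (isSunflower? (suc r) (suc t)) (choose (2 + j) (map (extend i inside) E))
    ≡⟨ count-choose-map (isSunflower? (suc r) (suc t)) (extend i inside) (2 + j) E ⟩
  count (isSunflower? (suc r) (suc t) ∘ map (extend i inside)) (choose (2 + j) E)
    ≤⟨ count-mono _ _ (All.map (λ {es} → remove es) (choose-length (2 + j) E)) ⟩
  count (isSunflower? r t ∘ map (extend i outside)) (choose (2 + j) E)
    ≡⟨ count-choose-map (isSunflower? r t) (extend i outside) (2 + j) E ⟨
  count (isSunflower? r t) (choose (2 + j) (map (extend i outside) E)) ∎
  where
    open ≤-Reasoning
    remove : ∀ es → length es ≡ 2 + j →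
      IsSunflower (suc r) (suc t) (map (extend i inside) es) → IsSunflower r t (map (extend i outside) es)
    remove (a ∷ b ∷ es) _ = sunflower-remove-vertex i a b es

module _ {m q : ℕ} {H : Hypergraph (suc m)} (U : Uniform (2 + q) H) (i : Fin (suc m)) where

  private
    S? : Decidable (IsSunflower {suc m} (2 + q) (1 + q))
    S? = isSunflower? (2 + q) (1 + q)
    Eᵢ Eₒ : List (Subset m)
    Eᵢ = edges (slice H i inside)
    Eₒ = edges (slice H i outside)
    C′ : ℕ → ℕ
    C′ j = (m ∸ suc q ∸ 1) C j

  -- The copies of S^{q+2}_{q+1,j+2} in H with exactly one edge, extend i inside a, through i.
  crossings : ℕ → ℕ
  crossings j = sum (map (λ a → count (S? ∘ (extend i inside a ∷_)) (choose (suc j) (map (extend i outside) Eₒ))) Eᵢ)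

  N-≤-vertex-split : ∀ j →
    N (2 + q) (1 + q) (2 + j) H ≤ N (2 + q) (1 + q) (2 + j) (delV H i) + N (1 + q) q (2 + j) (link H i) + crossings j
  N-≤-vertex-split j = begin
    count S? (choose (2 + j) (edges H))
      ≡⟨ ↭⇒SameChooseCounts (edges-↭-extend H i) S? IsSunflower-resp-↭ (2 + j) ⟩
    count S? (choose (2 + j) (through ++ avoiding))
      ≤⟨ count-choose-++-≤-singleˡ S? (λ i∈x i∈y S → sunflower-core-∈ S i∈x i∈y) (suc j)
           (All.map⁺ (All.universal (i∈extend-inside i) Eᵢ)) (All.map⁺ (All.universal (i∉extend-outside i) Eₒ)) ⟩
    count S? (choose (2 + j) through) + count S? (choose (2 + j) avoiding) + sum (map crossing through)
      ≤⟨ +-mono-≤ (+-mono-≤ (count-sunflowers-remove-vertex i j Eᵢ)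
                            (≤-reflexive (↭⇒SameChooseCounts (↭-sym (edges-delV H i)) S? IsSunflower-resp-↭ (2 + j))))
                  (≤-reflexive (cong sum (sym (map-∘ Eᵢ)))) ⟩
    count (isSunflower? (1 + q) q) (choose (2 + j) (map (extend i outside) Eᵢ)) + N (2 + q) (1 + q) (2 + j) (delV H i) + crossings j
      ≡⟨ cong (λ c → c + N (2 + q) (1 + q) (2 + j) (delV H i) + crossings j)
              (↭⇒SameChooseCounts (↭-sym (edges-link H i)) (isSunflower? (1 + q) q) IsSunflower-resp-↭ (2 + j)) ⟩
    N (1 + q) q (2 + j) (link H i) + N (2 + q) (1 + q) (2 + j) (delV H i) + crossings j
      ≡⟨ cong (_+ crossings j) (+-comm (N (1 + q) q (2 + j) (link H i)) _) ⟩
    N (2 + q) (1 + q) (2 + j) (delV H i) + N (1 + q) q (2 + j) (link H i) + crossings j ∎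
    where
      open ≤-Reasoning
      through avoiding : List (Subset (suc m))
      through  = map (extend i inside) Eᵢ
      avoiding = map (extend i outside) Eₒ
      crossing : Subset (suc m) → ℕ
      crossing x = count (S? ∘ (x ∷_)) (choose (suc j) avoiding)

  crossings-through-≤ : ∀ j {a} → ∣ a ∣ ≡ suc q →
    suc j * count (S? ∘ (extend i inside a ∷_)) (choose (suc j) (map (extend i outside) Eₒ)) ≤ C′ j * count (a ⊆?_) Eₒ
  crossings-through-≤ j {a} ∣a∣ = begin
    suc j * count (S? ∘ (extend i inside a ∷_)) (choose (suc j) (map (extend i outside) Eₒ))
      ≡⟨ cong (suc j *_) (count-choose-map (S? ∘ (extend i inside a ∷_)) (extend i outside) (suc j) Eₒ) ⟩
    suc j * count (λ cs → S? (extend i inside a ∷ map (extend i outside) cs)) (choose (suc j) Eₒ)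
      ≤⟨ *-monoʳ-≤ (suc j) (count-choose-≤-C (a ⊆?_) _ (sunflower-petals-⊇ i a _) (suc j) Eₒ) ⟩
    suc j * (d C suc j)
      ≡⟨ [k+1]*nC[k+1]≡n*[n∸1]Ck d j ⟩
    d * ((d ∸ 1) C j)
      ≤⟨ *-monoʳ-≤ d (C-monoˡ-≤ j (∸-monoˡ-≤ 1 (count-edges-⊇ (Uniform-slice-outside i U) ∣a∣))) ⟩
    d * C′ j
      ≡⟨ *-comm d (C′ j) ⟩
    C′ j * d ∎
    where
      open ≤-Reasoning
      d : ℕ
      d = count (a ⊆?_) Eₒ

  incidences-≤ : sum (map (λ a → count (a ⊆?_) Eₒ) Eᵢ) ≤ length Eₒ * (2 + q)
  incidences-≤ = begin
    sum (map (λ a → count (a ⊆?_) Eₒ) Eᵢ)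
      ≡⟨ sum-map-count-comm _⊆?_ Eᵢ Eₒ ⟩
    sum (map (λ c → count (_⊆? c) Eᵢ) Eₒ)
      ≤⟨ sum-map-≤-length* (All.map edges-inside (edges-uniform (Uniform-slice-outside i U))) ⟩
    length Eₒ * (2 + q) ∎
    where
      open ≤-Reasoning
      edges-inside : ∀ {c} → ∣ c ∣ ≡ 2 + q → count (_⊆? c) Eᵢ ≤ 2 + q
      edges-inside {c} ∣c∣ = ≤-trans (count-edges-⊆ (Uniform-slice-inside i U) c)
                                     (≤-reflexive (≡-trans (cong (_C suc q) ∣c∣) ([n+1]Cn≡n+1 (suc q))))

  crossings-≤ : ∀ j → suc j * crossings j ≤ eH (delV H i) * (2 + q) * ((m ∸ suc q ∸ 1) C j)
  crossings-≤ j = begin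
    suc j * crossings j
      ≡⟨ *-distribˡ-sum-map (suc j) _ Eᵢ ⟩
    sum (map (λ a → suc j * count (S? ∘ (extend i inside a ∷_)) (choose (suc j) (map (extend i outside) Eₒ))) Eᵢ)
      ≤⟨ sum-map-mono-≤ (All.map (crossings-through-≤ j) (edges-uniform (Uniform-slice-inside i U))) ⟩
    sum (map (λ a → C′ j * count (a ⊆?_) Eₒ) Eᵢ)
      ≡⟨ *-distribˡ-sum-map (C′ j) _ Eᵢ ⟨
    C′ j * sum (map (λ a → count (a ⊆?_) Eₒ) Eᵢ)
      ≤⟨ *-monoʳ-≤ (C′ j) incidences-≤ ⟩
    C′ j * (length Eₒ * (2 + q))
      ≡⟨ *-comm (C′ j) _ ⟩
    length Eₒ * (2 + q) * C′ j
      ≡⟨ cong (λ e → e * (2 + q) * C′ j) (eH-delV H i) ⟨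
    eH (delV H i) * (2 + q) * C′ j ∎
    where open ≤-Reasoning

  N-vertex-split-≤ : ∀ {k} → 2 ≤ k →
    (k ∸ 1) * N (2 + q) (1 + q) k H
      ≤ (k ∸ 1) * (N (2 + q) (1 + q) k (delV H i) + N (1 + q) q k (link H i))
        + eH (delV H i) * (2 + q) * ((m ∸ suc q ∸ 1) C (k ∸ 2))
  N-vertex-split-≤ {suc (suc j)} (s≤s (s≤s z≤n)) = begin
    suc j * N (2 + q) (1 + q) (2 + j) H
      ≤⟨ *-monoʳ-≤ (suc j) (N-≤-vertex-split j) ⟩
    suc j * (split + crossings j)
      ≡⟨ *-distribˡ-+ (suc j) split (crossings j) ⟩
    suc j * split + suc j * crossings j
      ≤⟨ +-monoʳ-≤ (suc j * split) (crossings-≤ j) ⟩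
    suc j * split + eH (delV H i) * (2 + q) * C′ j ∎
    where
      open ≤-Reasoning
      split : ℕ
      split = N (2 + q) (1 + q) (2 + j) (delV H i) + N (1 + q) q (2 + j) (link H i)

lemma3p1 : (r n : ℕ) → 2 ≤ r → (H : Hypergraph n) → Uniform r H → (i : Fin n) → (k : ℕ) → 1 ≤ k →
  (k ≡ 1 → N r (r ∸ 1) 1 H ≡ N r (r ∸ 1) 1 (delV H i) + N (r ∸ 1) (r ∸ 2) 1 (link H i))
  × (2 ≤ k → (k ∸ 1) * N r (r ∸ 1) k H
               ≤ (k ∸ 1) * (N r (r ∸ 1) k (delV H i) + N (r ∸ 1) (r ∸ 2) k (link H i))
                 + eH (delV H i) * r * ((n ∸ r ∸ 1) C (k ∸ 2)))
lemma3p1 _            zero    _                  _ _ () _ _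
lemma3p1 (suc (suc q)) (suc m) (s≤s (s≤s z≤n)) H U i k _ =
  (λ _ → N-singletons-vertex-split U (n≤1+n _) (n≤1+n q) i) , N-vertex-split-≤ U i
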